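{- Let $\pi\in\mathcal{OP}_{n,k}$ with leading letters $b_1,\dots,b_k$ (the first elements of the blocks in minimaj order), and let $\pi'=\mathsf{read}(\varphi(\pi))\in\mathcal{WOP}_{n,k}$. Then: (1) the last $k$ letters of the concatenated word of $\pi'$ are $b_1,\dots,b_k$ (in this order), and for $1\leqslant i<k$, $b_i$ and $b_{i+1}$ lie in different blocks of $\pi'$ if and only if $b_i\leqslant b_{i+1}$; (2) if $b_1,\dots,b_k$ are contained in precisely $k-j$ blocks of $\pi'$, then there are at least $j$ descents between consecutive letters lying in a common block among the blocks of $\pi'$ containing the $b_i$'s.
   Context: $\mathcal{OP}_{n,k}$ is the set of sequences $\pi=(\pi_1\mid\cdots\mid\pi_k)$ of nonempty finite sets of positive integers with $\sum|\pi_i|=n$; $\mathcal{WOP}_{n,k}$ is the analogous set where blocks may be empty. Minimaj order: write $\pi_k$ increasingly; for $i=k-1,\dots,1$, let $r_i$ be the largest element of $\pi_i$ that is $\leqslant$ the leftmost element of the arranged $\pi_{i+1}$; if none, arrange $\pi_i$ increasingly, else arrange increasingly and rotate cyclically so $r_i$ is rightmost. The concatenation is the minimaj word $u_1\cdots u_n$; $b_i$ is the first letter of $\pi_i$ (a leading letter). A descent of a word is a position $j$ with $w_j>w_{j+1}$; $\mathsf{D}(\pi)$ is the descent set of $u$; a descent at $j$ lies in block $\pi_i$ if $u_j\in\pi_i$. The map $\varphi$: if $\mathsf{D}(\pi)=\{\delta_1<\cdots<\delta_\ell\}$ and the blocks containing descents are $\pi_{\eta_1},\dots,\pi_{\eta_\ell}$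 ($\eta_1<\cdots<\eta_\ell$), set $\delta_0=\eta_0=0$, $\delta_{\ell+1}=n$, $\eta_{\ell+1}=k$, $d_j=\delta_j-\delta_{j-1}$, $i_j=\eta_j-\eta_{j-1}$. Then $\varphi(\pi)=T_1\times\cdots\times T_{\ell+1}$, where for $1\leqslant j\leqslant \ell$, $T_j$ is the column (increasing top to bottom) of the non-leading letters among $u_{\delta_{\ell-j+1}+1},\dots,u_{\delta_{\ell-j+2}}$ (possibly empty), and $T_{\ell+1}$ is the semistandard ribbon tableau of shape $(1^{d_1-i_1},i_1,\dots,i_{\ell+1})$ (rows numbered bottom to top, row $j+1$ starting in the column of the last box of row $j$) with row $d_1-i_1+j$ filled left to right by $b_{\eta_{j-1}+1},\dots,b_{\eta_j}$ and the bottom $d_1-i_1$ boxes of the first column filled, increasing top to bottom, by the non-leading letters among $u_1,\dots,u_{d_1}$. $\mathsf{read}(T_1\times\cdots\times T_{\ell+1})$ is the weak ordered multiset partition whose blocks are the columns of $T_1,\dots,T_\ell$ followed by the columns of $T_{\ell+1}$ from left to right, each column being one block (an empty $T_j$ giving an empty block) read from bottom to top (hence in decreasing order); it has $k$ blocks. The concatenated word of a weak ordered multiset partition is the concatenation of its blocks in the given orders. -}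

module Defs where

open import Data.Nat using (ℕ; zero; suc; _+_; _∸_; _≤_; _<_; _≤?_; _<ᵇ_; _≡ᵇ_)
open import Data.Nat.Properties using (≤-decTotalOrder)
open import Data.Bool using (Bool; true; false; if_then_else_; not)
open import Data.Product using (_×_; _,_; proj₁; proj₂)
open import Data.List using (List; []; _∷_; _++_; [_]; map; length; filter; filterᵇ;
  take; drop; reverse; concat; zipWith; upTo)
open import Data.Bool.ListAction using (any)
open import Data.Nat.ListAction using (sum)
open import Data.List.Relation.Unary.All using (All)
open import Data.List.Relation.Unary.Linked using (Linked)
open import Relation.Binary.PropositionalEquality using (_≡_; _≢_)
open import Data.List.Sort.InsertionSort.Base ≤-decTotalOrder using (sort)

-- Ordered set partitions OP_{n,k}.
-- A finite set of positive integers is represented canonically by the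
-- strictly increasing list of its elements.

IsFinSetPos : List ℕ → Set
IsFinSetPos B = Linked _<_ B × All (1 ≤_) B

IsOP : ℕ → ℕ → List (List ℕ) → Set
IsOP n k π = (length π ≡ k)
           × All (λ B → (B ≢ []) × IsFinSetPos B) π
           × (sum (map length π) ≡ n)

headOr0 : List ℕ → ℕ
headOr0 []      = 0
headOr0 (x ∷ _) = x

nth : List ℕ → ℕ → ℕ
nth []       _       = 0
nth (x ∷ _)  zero    = x
nth (_ ∷ xs) (suc i) = nth xs i

-- positions a+1, …, b (1-based) of a word
slice : {A : Set} → ℕ → ℕ → List A → List A
slice a b w = take (b ∸ a) (drop a w)

-- 0-based index of the block containing the 0-based position p of the
-- concatenated word of a (weak) ordered multiset partition
blockOf : List (List ℕ) → ℕ → ℕ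
blockOf []       p = 0
blockOf (B ∷ Bs) p = if p <ᵇ length B then 0 else suc (blockOf Bs (p ∸ length B))

-- descent positions (1-based, starting the count at i) of a word:
-- positions j with w_j > w_{j+1}
descentsFrom : ℕ → List ℕ → List ℕ
descentsFrom i []                 = []
descentsFrom i (x ∷ [])           = []
descentsFrom i (x ∷ ys@(y ∷ _))   =
  (if y <ᵇ x then i ∷ [] else []) ++ descentsFrom (suc i) ys

descents : List ℕ → List ℕ
descents = descentsFrom 1

-- B is the increasing arrangement of π_i, L the leftmost element of the
-- arranged π_{i+1}.  The elements ≤ L form an initial segment of B of
-- length m, whose last element is r_i; rotating B cyclically so that r_i
-- is rightmost gives  drop m B ++ take m B.  If no element is ≤ L (m = 0)
-- this is B itself, i.e. the increasing arrangement.
arrangeBlock : ℕ → List ℕ → List ℕ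
arrangeBlock L B = drop m B ++ take m B
  where m = length (filter (_≤? L) B)

minimajBlocks : List (List ℕ) → List (List ℕ)
minimajBlocks []       = []
minimajBlocks (B ∷ Bs) with minimajBlocks Bs
... | []       = B ∷ []
... | (C ∷ Cs) = arrangeBlock (headOr0 C) B ∷ C ∷ Cs

minimajWord : List (List ℕ) → List ℕ
minimajWord π = concat (minimajBlocks π)

leading : List (List ℕ) → List ℕ
leading π = map headOr0 (minimajBlocks π)

-- Letters of the minimaj word annotated with (value , is-leading?)

Letter : Set
Letter = ℕ × Bool

markBlock : List ℕ → List Letter
markBlock []       = []
markBlock (x ∷ xs) = (x , true) ∷ map (λ y → (y , false)) xs

annotated : List (List ℕ) → List Letter
annotated π = concat (map markBlock (minimajBlocks π))

nonLeading : List Letter → List ℕ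
nonLeading ls = map proj₁ (filterᵇ (λ l → not (proj₂ l)) ls)

-- a column filled (increasing top to bottom) by the given letters,
-- read from bottom to top
columnRead : List ℕ → List ℕ
columnRead xs = reverse (sort xs)

-- Ribbon tableau: given the first column (already read bottom to top)
-- and the rows (bottom to top, each filled left to right), where row j+1
-- starts in the column of the last box of row j, produce the columns
-- from left to right, each read bottom to top.

mutual
  ribbonCols : List ℕ → List (List ℕ) → List (List ℕ)
  ribbonCols cur []              = cur ∷ []
  ribbonCols cur ([] ∷ rows)     = ribbonCols cur rows
  ribbonCols cur ((x ∷ xs) ∷ rows) = rowRest (cur ++ [ x ]) xs rows

  -- cur is the open column (containing the last placed box of the row);
  -- the remaining boxes of the row each start a new column
  rowRest : List ℕ → List ℕ → List (List ℕ) → List (List ℕ)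
  rowRest cur []       rows = ribbonCols cur rows
  rowRest cur (y ∷ ys) rows = cur ∷ rowRest [ y ] ys rows

-- rows: row j consists of b_{η_{j-1}+1}, …, b_{η_j}, with η_0 = 0 and the
-- last row ending at b_k
cutRows : List ℕ → ℕ → List ℕ → List (List ℕ)
cutRows bs prev []       = bs ∷ []
cutRows bs prev (e ∷ es) = take (e ∸ prev) bs ∷ cutRows (drop (e ∸ prev) bs) e es

readPhi : List (List ℕ) → List (List ℕ)
readPhi π = Tcols ++ ribbonCols (columnRead (nonLeading (slice 0 d₁ w))) rows
  where
    A   = minimajBlocks π
    w   = annotated π
    u   = minimajWord π
    n   = length u
    k   = length A
    bs  = leading π
    δs  = descents u
    bounds = 0 ∷ (δs ++ n ∷ [])
    segs : List (List Letter)
    segs = zipWith (λ a b → slice a b w) bounds (Data.List.drop 1 bounds)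
    d₁  = nth (δs ++ n ∷ []) 0
    -- η_j : (1-based) index of the block containing u_{δ_j}
    ηs  = map (λ δ → suc (blockOf A (δ ∸ 1))) δs
    -- T_1, …, T_ℓ : T_j uses segment δ_{ℓ-j+1}+1 … δ_{ℓ-j+2}
    Tcols = map (λ s → columnRead (nonLeading s)) (reverse (drop 1 segs))
    rows  = cutRows bs 0 ηs

word : List (List ℕ) → List ℕ
word = concat

des : List ℕ → ℕ
des w = length (descents w)

-- 0-based position of b_{i+1} (i < k), assuming (as claimed) that these
-- are the last k letters of the concatenated word
bPos : List (List ℕ) → ℕ → ℕ → ℕ
bPos π' k i = length (word π') ∸ k + i

containsB : List (List ℕ) → ℕ → ℕ → Bool
containsB π' k c = any (λ i → blockOf π' (bPos π' k i) ≡ᵇ c) (upTo k)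

numBlocksWithB : List (List ℕ) → ℕ → ℕ
numBlocksWithB π' k = length (filterᵇ (containsB π' k) (upTo (length π')))

descentsInBBlocks : List (List ℕ) → ℕ → ℕ
descentsInBBlocks π' k =
  sum (zipWith (λ c B → if containsB π' k c then des B else 0)
               (upTo (length π')) π')

-- In minimaj order a block B, followed by the first letter L of the next block, has exactly
-- one descent when L is smaller than the first letter of B and none otherwise.  Hence the
-- blocks containing the descents of the minimaj word are the positions of the descents of
-- the leading word b₁ ⋯ b_k, so the rows of the ribbon of φ(π) are the maximal weakly
-- increasing runs of b₁ ⋯ b_k, and its columns, read bottom to top, are its maximal strictly
-- decreasing runs (the first one stacked on the non-leading letters among u₁, …, u_{d₁}).  So
-- b₁ ⋯ b_k ends the word of π′, b_i and b_{i+1} share a column exactly when b_i > b_{i+1}, and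
-- a column holding m of the b_i contains at least m − 1 descents.
module Submission where

open import Data.Bool using (Bool; true; false; if_then_else_; T)
open import Data.Bool.Properties using (T-≡)
open import Data.Empty using (⊥-elim)
open import Data.List using (List; []; _∷_; _++_; map; length; drop; take; filterᵇ; concat; zipWith; applyUpTo)
open import Data.List.Membership.Propositional using (lose)
open import Data.List.Membership.Propositional.Properties using (∈-upTo⁺)
open import Data.List.Properties
  using (map-++; map-∘; map-cong-local; length-++; length-++-comm; length-++-≤ˡ; length-map;
         ++-assoc; ++-identityʳ; concat-++; filter-++; filter-all; filter-none)
open import Data.List.Relation.Unary.All as All using (All; []; _∷_)
open import Data.List.Relation.Unary.Any.Properties using (any⁺)
open import Data.List.Relation.Unary.Linked as Linked using (Linked; []; [-]; _∷_)
open import Data.List.Relation.Unary.Linked.Properties using (Linked⇒All)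
open import Data.Nat using (ℕ; zero; suc; _+_; _∸_; _≤_; _<_; z≤n; s≤s; _<ᵇ_; _≤?_)
open import Data.Nat.ListAction using (sum)
open import Data.Nat.Properties
open import Data.Product using (∃; ∃₂; _×_; _,_)
open import Function.Bundles using (_⇔_; mk⇔; Equivalence)
import Function.Properties.Equivalence as ⇔
open import Relation.Binary.PropositionalEquality
open import Relation.Nullary using (yes; no)
open import Algebra.Properties.CommutativeSemigroup +-commutativeSemigroup using (x∙yz≈y∙xz)

open import Defs

<⇒<ᵇ≡true : ∀ {m n} → m < n → (m <ᵇ n) ≡ true
<⇒<ᵇ≡true m<n = Equivalence.to T-≡ (<⇒<ᵇ m<n)

<ᵇ≡true⇒< : ∀ {m n} → (m <ᵇ n) ≡ true → m < n
<ᵇ≡true⇒< {m} {n} eq = <ᵇ⇒< m n (Equivalence.from T-≡ eq)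

≥⇒<ᵇ≡false : ∀ {m n} → n ≤ m → (m <ᵇ n) ≡ false
≥⇒<ᵇ≡false {m} {n} n≤m with m <ᵇ n in eq
... | false = refl
... | true  = ⊥-elim (<⇒≱ (<ᵇ≡true⇒< eq) n≤m)

<ᵇ≡false⇒≥ : ∀ {m n} → (m <ᵇ n) ≡ false → n ≤ m
<ᵇ≡false⇒≥ eq = ≮⇒≥ (λ m<n → subst T eq (<⇒<ᵇ m<n))

drop-length-++ : ∀ {A : Set} (xs ys : List A) → drop (length xs) (xs ++ ys) ≡ ys
drop-length-++ []       ys = refl
drop-length-++ (x ∷ xs) ys = drop-length-++ xs ys

take-length-++ : ∀ {A : Set} (xs ys : List A) → take (length xs) (xs ++ ys) ≡ xs
take-length-++ []       ys = refl
take-length-++ (x ∷ xs) ys = cong (x ∷_) (take-length-++ xs ys)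

Linked-++⁻ : ∀ {A : Set} {R : A → A → Set} xs {ys} → Linked R (xs ++ ys) → Linked R xs × Linked R ys
Linked-++⁻ []            l       = [] , l
Linked-++⁻ (x ∷ [])      l       = [-] , Linked.tail l
Linked-++⁻ (x ∷ x′ ∷ xs) (r ∷ l) with Linked-++⁻ (x′ ∷ xs) l
... | lxs , lys = r ∷ lxs , lys

Linked-∷ʳ : ∀ {A : Set} {R : A → A → Set} {y} xs → Linked R xs → All (λ x → R x y) xs → Linked R (xs ++ y ∷ [])
Linked-∷ʳ []            _       _        = [-]
Linked-∷ʳ (x ∷ [])      _       (r ∷ []) = r ∷ [-]
Linked-∷ʳ (x ∷ x′ ∷ xs) (r ∷ l) (_ ∷ rs) = r ∷ Linked-∷ʳ (x′ ∷ xs) l rs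

descentsFrom-suc : ∀ s w → descentsFrom (suc s) w ≡ map suc (descentsFrom s w)
descentsFrom-suc s []           = refl
descentsFrom-suc s (x ∷ [])     = refl
descentsFrom-suc s (x ∷ ys@(y ∷ _)) with y <ᵇ x | descentsFrom-suc (suc s) ys
... | true  | ih = cong (suc s ∷_) ih
... | false | ih = ih

descentsFrom-≥ : ∀ s w → All (s ≤_) (descentsFrom s w)
descentsFrom-≥ s []           = []
descentsFrom-≥ s (x ∷ [])     = []
descentsFrom-≥ s (x ∷ ys@(y ∷ _)) with y <ᵇ x | All.map (≤-trans (n≤1+n s)) (descentsFrom-≥ (suc s) ys)
... | true  | ih = ≤-refl ∷ ih
... | false | ih = ih

descentsFrom-sorted : ∀ s {w} → Linked _≤_ w → descentsFrom s w ≡ []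
descentsFrom-sorted s []                        = refl
descentsFrom-sorted s [-]                       = refl
descentsFrom-sorted s {x ∷ y ∷ _} (x≤y ∷ sorted) rewrite ≥⇒<ᵇ≡false x≤y =
  descentsFrom-sorted (suc s) sorted

descentsFrom-++ : ∀ s xs y ys →
  descentsFrom s (xs ++ y ∷ ys) ≡ descentsFrom s (xs ++ y ∷ []) ++ descentsFrom (s + length xs) (y ∷ ys)
descentsFrom-++ s []            y ys rewrite +-identityʳ s = refl
descentsFrom-++ s (x ∷ [])      y ys
  rewrite +-comm s 1 | ++-identityʳ (if y <ᵇ x then s ∷ [] else []) = refl
descentsFrom-++ s (x ∷ x′ ∷ xs) y ys
  rewrite descentsFrom-++ (suc s) (x′ ∷ xs) y ys | +-suc s (suc (length xs)) =
  sym (++-assoc (if x′ <ᵇ x then s ∷ [] else []) _ _)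

descentsFrom-join : ∀ s x xs y ys → Linked _≤_ (x ∷ xs) → All (y <_) (x ∷ xs) → Linked _≤_ (y ∷ ys) →
  descentsFrom s (x ∷ xs ++ y ∷ ys) ≡ (s + length xs) ∷ []
descentsFrom-join s x []        y ys _           (y<x ∷ []) sorted
  rewrite <⇒<ᵇ≡true y<x | descentsFrom-sorted (suc s) sorted | +-identityʳ s = refl
descentsFrom-join s x (x′ ∷ xs) y ys (x≤x′ ∷ l) (_ ∷ y<xs) sorted
  rewrite ≥⇒<ᵇ≡false x≤x′ | descentsFrom-join (suc s) x′ xs y ys l y<xs sorted | +-suc s (length xs) = refl

data DescentsBefore (L : ℕ) : List ℕ → Set where
  none : ∀ {b B} → b ≤ L → (∀ s → descentsFrom s (b ∷ B ++ L ∷ []) ≡ []) → DescentsBefore L (b ∷ B)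
  one  : ∀ {b B} t → t ≤ length B → L < b →
         (∀ s → descentsFrom s (b ∷ B ++ L ∷ []) ≡ (s + t) ∷ []) → DescentsBefore L (b ∷ B)

splitAt : ∀ L B → Linked _<_ B → ∃₂ λ P Q → B ≡ P ++ Q × All (_≤ L) P × All (L <_) Q
splitAt L []       _      = [] , [] , refl , [] , []
splitAt L (x ∷ xs) sorted with x ≤? L
... | no  x≰L = [] , x ∷ xs , refl , [] , Linked⇒All <-trans (≰⇒> x≰L) sorted
... | yes x≤L with splitAt L xs (Linked.tail sorted)
...   | P , Q , refl , P≤L , L<Q = x ∷ P , Q , refl , x≤L ∷ P≤L , L<Q

arrangeBlock-split : ∀ L P Q → All (_≤ L) P → All (L <_) Q → arrangeBlock L (P ++ Q) ≡ Q ++ P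
arrangeBlock-split L P Q P≤L L<Q
  rewrite filter-++ (_≤? L) P Q | filter-all (_≤? L) P≤L | filter-none (_≤? L) (All.map <⇒≱ L<Q)
        | ++-identityʳ P | drop-length-++ P Q | take-length-++ P Q = refl

∷ʳ-head≤ : ∀ L P → All (_≤ L) P → ∃₂ λ y ys → P ++ L ∷ [] ≡ y ∷ ys × y ≤ L
∷ʳ-head≤ L []      _         = L , [] , refl , ≤-refl
∷ʳ-head≤ L (p ∷ P) (p≤L ∷ _) = p , P ++ L ∷ [] , refl , p≤L

rotation-descents : ∀ L P Q → P ++ Q ≢ [] → Linked _≤_ P → All (_≤ L) P → Linked _≤_ Q → All (L <_) Q →
  DescentsBefore L (Q ++ P)
rotation-descents L []      []      P++Q≢[] _  _         _  _ = ⊥-elim (P++Q≢[] refl)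
rotation-descents L (p ∷ P) []      _       sP (p≤L ∷ P≤L) _ _ =
  none p≤L (λ s → descentsFrom-sorted s (Linked-∷ʳ (p ∷ P) sP (p≤L ∷ P≤L)))
rotation-descents L P (q ∷ Q) _ sP P≤L sQ (L<q ∷ L<Q) with ∷ʳ-head≤ L P P≤L
... | y , ys , P∷ʳL≡y∷ys , y≤L =
  one (length Q) Q≤QP L<q λ s → begin
    descentsFrom s (q ∷ (Q ++ P) ++ L ∷ [])  ≡⟨ cong (λ w → descentsFrom s (q ∷ w)) (++-assoc Q P (L ∷ [])) ⟩
    descentsFrom s (q ∷ Q ++ P ++ L ∷ [])    ≡⟨ cong (λ w → descentsFrom s (q ∷ Q ++ w)) P∷ʳL≡y∷ys ⟩
    descentsFrom s (q ∷ Q ++ y ∷ ys)         ≡⟨ descentsFrom-join s q Q y ys sQ y<qQ sorted ⟩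
    (s + length Q) ∷ []                      ∎
  where
  open ≡-Reasoning
  Q≤QP : length Q ≤ length (Q ++ P)
  Q≤QP = length-++-≤ˡ Q
  y<qQ : All (y <_) (q ∷ Q)
  y<qQ = All.map (≤-<-trans y≤L) (L<q ∷ L<Q)
  sorted : Linked _≤_ (y ∷ ys)
  sorted = subst (Linked _≤_) P∷ʳL≡y∷ys (Linked-∷ʳ P sP P≤L)

arrangeBlock-descents : ∀ L B → B ≢ [] → Linked _<_ B → DescentsBefore L (arrangeBlock L B)
arrangeBlock-descents L B B≢[] sorted with splitAt L B sorted
... | P , Q , refl , P≤L , L<Q with Linked-++⁻ P (Linked.map <⇒≤ sorted)
...   | sP , sQ rewrite arrangeBlock-split L P Q P≤L L<Q = rotation-descents L P Q B≢[] sP P≤L sQ L<Q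

data Arranged : List (List ℕ) → Set where
  []  : Arranged []
  [_] : ∀ {b B} → Linked _≤_ (b ∷ B) → Arranged ((b ∷ B) ∷ [])
  _∷_ : ∀ {B c C Cs} → DescentsBefore c B → Arranged ((c ∷ C) ∷ Cs) → Arranged (B ∷ (c ∷ C) ∷ Cs)

minimajBlocks-arranged : ∀ π → All (λ B → (B ≢ []) × IsFinSetPos B) π → Arranged (minimajBlocks π)
minimajBlocks-arranged []       [] = []
minimajBlocks-arranged ([] ∷ Bs)      ((B≢[] , _) ∷ _)           = ⊥-elim (B≢[] refl)
minimajBlocks-arranged ((b ∷ B) ∷ Bs) ((_ , sorted , _) ∷ blocks)
  with minimajBlocks Bs | minimajBlocks-arranged Bs blocks
... | []           | _        = [ Linked.map <⇒≤ sorted ]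
... | [] ∷ _       | () ∷ _
... | (c ∷ C) ∷ Cs | arranged = arrangeBlock-descents c (b ∷ B) (λ ()) sorted ∷ arranged

blockOf-< : ∀ B Bs {p} → p < length B → blockOf (B ∷ Bs) p ≡ 0
blockOf-< B Bs p<B rewrite <⇒<ᵇ≡true p<B = refl

blockOf-+ : ∀ B Bs r → blockOf (B ∷ Bs) (length B + r) ≡ suc (blockOf Bs r)
blockOf-+ B Bs r rewrite ≥⇒<ᵇ≡false (m≤m+n (length B) r) | m+n∸m≡n (length B) r = refl

∸-split : ∀ m n δ → m + n ≤ δ → δ ∸ m ≡ n + (δ ∸ (m + n))
∸-split m n δ m+n≤δ = begin
  δ ∸ m                       ≡⟨ cong (_∸ m) (sym (m+[n∸m]≡n m+n≤δ)) ⟩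
  m + n + (δ ∸ (m + n)) ∸ m   ≡⟨ cong (_∸ m) (+-assoc m n _) ⟩
  m + (n + (δ ∸ (m + n))) ∸ m ≡⟨ m+n∸m≡n m _ ⟩
  n + (δ ∸ (m + n))           ∎
  where open ≡-Reasoning

-- blockIndex A 1 δ is η of the paper: the 1-based index of the block of A containing u_δ
blockIndex : List (List ℕ) → ℕ → ℕ → ℕ
blockIndex A s δ = suc (blockOf A (δ ∸ s))

blockIndex-∷ : ∀ m B Bs {D} → All (m + length B ≤_) D →
  map (blockIndex (B ∷ Bs) m) D ≡ map suc (map (blockIndex Bs (m + length B)) D)
blockIndex-∷ m B Bs {D} D≥ = trans (map-cong-local (All.map shift D≥)) (map-∘ D)
  where
  shift : ∀ {δ} → m + length B ≤ δ → blockIndex (B ∷ Bs) m δ ≡ suc (blockIndex Bs (m + length B) δ)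
  shift {δ} le = cong suc (trans (cong (blockOf (B ∷ Bs)) (∸-split m (length B) δ le)) (blockOf-+ B Bs _))

blockIndex-junction : ∀ s {c B} Bs → DescentsBefore c B →
  map (blockIndex (B ∷ Bs) (suc s)) (descentsFrom (suc s) (B ++ c ∷ [])) ≡ (if c <ᵇ headOr0 B then 1 ∷ [] else [])
blockIndex-junction s Bs (none b≤c descents) rewrite descents (suc s) | ≥⇒<ᵇ≡false b≤c = refl
blockIndex-junction s {B = B} Bs (one t t≤B c<b descents)
  rewrite descents (suc s) | <⇒<ᵇ≡true c<b | m+n∸m≡n (suc s) t | blockOf-< B Bs (s≤s t≤B) = refl

descentBlocks : ∀ s {A} → Arranged A →
  map (blockIndex A (suc s)) (descentsFrom (suc s) (concat A)) ≡ descentsFrom 1 (map headOr0 A)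
descentBlocks s []                   = refl
descentBlocks s {(b ∷ B) ∷ []} [ sorted ] rewrite ++-identityʳ B | descentsFrom-sorted (suc s) sorted = refl
descentBlocks s {B ∷ (c ∷ C) ∷ Cs} (step ∷ arranged) = begin
  map f (descentsFrom (suc s) (B ++ c ∷ C ++ concat Cs)) ≡⟨ cong (map f) (descentsFrom-++ (suc s) B c _) ⟩
  map f (D₁ ++ D₂)                                     ≡⟨ map-++ f D₁ D₂ ⟩
  map f D₁ ++ map f D₂                                 ≡⟨ cong₂ _++_ (blockIndex-junction s ((c ∷ C) ∷ Cs) step) later ⟩
  descentsFrom 1 (map headOr0 (B ∷ (c ∷ C) ∷ Cs))      ∎
  where
  open ≡-Reasoning
  f  = blockIndex (B ∷ (c ∷ C) ∷ Cs) (suc s)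
  D₁ = descentsFrom (suc s) (B ++ c ∷ [])
  D₂ = descentsFrom (suc s + length B) (c ∷ C ++ concat Cs)
  later : map f D₂ ≡ descentsFrom 2 (map headOr0 ((c ∷ C) ∷ Cs))
  later = begin
    map f D₂                                                  ≡⟨ blockIndex-∷ (suc s) B ((c ∷ C) ∷ Cs) (descentsFrom-≥ _ (c ∷ C ++ concat Cs)) ⟩
    map suc (map (blockIndex ((c ∷ C) ∷ Cs) (suc s + length B)) D₂) ≡⟨ cong (map suc) (descentBlocks (s + length B) arranged) ⟩
    map suc (descentsFrom 1 (map headOr0 ((c ∷ C) ∷ Cs)))     ≡⟨ sym (descentsFrom-suc 1 (c ∷ map headOr0 Cs)) ⟩
    descentsFrom 2 (map headOr0 ((c ∷ C) ∷ Cs))               ∎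

consFirst : ℕ → List (List ℕ) → List (List ℕ)
consFirst x []       = (x ∷ []) ∷ []
consFirst x (r ∷ rs) = (x ∷ r) ∷ rs

ascendingRuns : ℕ → List ℕ → List (List ℕ)
ascendingRuns x []       = (x ∷ []) ∷ []
ascendingRuns x (y ∷ ys) = if y <ᵇ x then (x ∷ []) ∷ ascendingRuns y ys else consFirst x (ascendingRuns y ys)

-- col ++ ys cut before each weak ascent inside p ∷ ys, where p is the last letter of col
descendingColumns : List ℕ → ℕ → List ℕ → List (List ℕ)
descendingColumns col p []       = col ∷ []
descendingColumns col p (y ∷ ys) =
  if y <ᵇ p then descendingColumns (col ++ y ∷ []) y ys else col ∷ descendingColumns (y ∷ []) y ys

cutRows-∷ : ∀ x xs p es → All (p <_) es → cutRows (x ∷ xs) p es ≡ consFirst x (cutRows xs (suc p) es)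
cutRows-∷ x xs p []       _             = refl
cutRows-∷ x xs p (_ ∷ es) (s≤s p≤e ∷ _) rewrite +-∸-assoc 1 p≤e = refl

cutRows-descents : ∀ p x xs → cutRows (x ∷ xs) p (descentsFrom (suc p) (x ∷ xs)) ≡ ascendingRuns x xs
cutRows-descents p x []       = refl
cutRows-descents p x (y ∷ ys) with y <ᵇ x
... | true  rewrite m+n∸n≡m 1 p = cong ((x ∷ []) ∷_) (cutRows-descents (suc p) y ys)
... | false = trans (cutRows-∷ x (y ∷ ys) p _ (All.map (≤-trans (n≤1+n _)) (descentsFrom-≥ (suc (suc p)) (y ∷ ys))))
                    (cong (consFirst x) (cutRows-descents (suc p) y ys))

ascendingRuns-head : ∀ y ys → ∃₂ λ r rs → ascendingRuns y ys ≡ (y ∷ r) ∷ rs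
ascendingRuns-head y []       = [] , [] , refl
ascendingRuns-head y (z ∷ zs) with z <ᵇ y
... | true  = [] , _ , refl
... | false with ascendingRuns-head z zs
...   | r , rs , eq rewrite eq = z ∷ r , rs , refl

ribbonCols-ascendingRuns : ∀ col x xs → ribbonCols col (ascendingRuns x xs) ≡ descendingColumns (col ++ x ∷ []) x xs
ribbonCols-ascendingRuns col x []       = refl
ribbonCols-ascendingRuns col x (y ∷ ys) with y <ᵇ x
... | true  = ribbonCols-ascendingRuns (col ++ x ∷ []) y ys
... | false with ascendingRuns-head y ys | ribbonCols-ascendingRuns [] y ys
...   | r , rs , eq | ih rewrite eq = cong ((col ++ x ∷ []) ∷_) ih

concat-descendingColumns : ∀ col p ys → concat (descendingColumns col p ys) ≡ col ++ ys
concat-descendingColumns col p []       = refl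
concat-descendingColumns col p (y ∷ ys) with y <ᵇ p
... | true  = trans (concat-descendingColumns (col ++ y ∷ []) y ys) (++-assoc col (y ∷ []) ys)
... | false = cong (col ++_) (concat-descendingColumns (y ∷ []) y ys)

length-∷ʳ : ∀ (col : List ℕ) y {c} → length col ≡ suc c → length (col ++ y ∷ []) ≡ suc (suc c)
length-∷ʳ col y |col| = trans (length-++-comm col (y ∷ [])) (cong suc |col|)

blockOf-descendingColumns-< : ∀ col p ys {q} → q < length col → blockOf (descendingColumns col p ys) q ≡ 0
blockOf-descendingColumns-< col p []       q<col = blockOf-< col [] q<col
blockOf-descendingColumns-< col p (y ∷ ys) q<col with y <ᵇ p
... | true  = blockOf-descendingColumns-< (col ++ y ∷ []) y ys
                (≤-trans q<col (length-++-≤ˡ col))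
... | false = blockOf-< col (descendingColumns (y ∷ []) y ys) q<col

lastPosition<length : ∀ c (col : List ℕ) → length col ≡ suc c → c + 0 < length col
lastPosition<length c col |col| = subst (c + 0 <_) (sym |col|) (s≤s (≤-reflexive (+-identityʳ c)))

blockOf-∷-suc : ∀ c col Bs j → length col ≡ suc c → blockOf (col ∷ Bs) (c + suc j) ≡ suc (blockOf Bs j)
blockOf-∷-suc c col Bs j |col| =
  trans (cong (blockOf (col ∷ Bs)) (trans (+-suc c j) (cong (_+ j) (sym |col|)))) (blockOf-+ col Bs j)

≢-offset : ∀ m {x y a b} → x ≡ m + a → y ≡ m + b → (x ≢ y) ⇔ (a ≢ b)
≢-offset m refl refl = mk⇔ (λ x≢y a≡b → x≢y (cong (m +_) a≡b)) (λ a≢b x≡y → a≢b (+-cancelˡ-≡ m _ _ x≡y))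

-- col has length c + 1, so the letters p ∷ ys sit at the positions c, c + 1, …
descendingColumns-separate : ∀ c col p ys → length col ≡ suc c → ∀ i → i < length ys →
  let G = descendingColumns col p ys in
  (blockOf G (c + i) ≢ blockOf G (c + suc i)) ⇔ (nth (p ∷ ys) i ≤ nth (p ∷ ys) (suc i))
descendingColumns-separate c col p [] _ i ()
descendingColumns-separate c col p (y ∷ ys) |col| i i< with y <ᵇ p in y<ᵇp
descendingColumns-separate c col p (y ∷ ys) |col| zero _ | true =
  mk⇔ (λ differ → ⊥-elim (differ (trans (inFirst c<) (sym (inFirst 1+c<)))))
      (λ p≤y → ⊥-elim (<⇒≱ (<ᵇ≡true⇒< y<ᵇp) p≤y))
  where
  inFirst : ∀ {q} → q < suc (suc c) → blockOf (descendingColumns (col ++ y ∷ []) y ys) q ≡ 0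
  inFirst q< = blockOf-descendingColumns-< (col ++ y ∷ []) y ys (subst (_ <_) (sym (length-∷ʳ col y |col|)) q<)
  c< : c + 0 < suc (suc c)
  c< = s≤s (≤-trans (≤-reflexive (+-identityʳ c)) (n≤1+n c))
  1+c< : c + 1 < suc (suc c)
  1+c< = s≤s (≤-reflexive (+-comm c 1))
descendingColumns-separate c col p (y ∷ ys) |col| (suc i) (s≤s i<) | true
  rewrite +-suc c i | +-suc c (suc i) =
  descendingColumns-separate (suc c) (col ++ y ∷ []) y ys (length-∷ʳ col y |col|) i i<
descendingColumns-separate c col p (y ∷ ys) |col| zero _ | false =
  mk⇔ (λ _ → <ᵇ≡false⇒≥ y<ᵇp) (λ _ same → 0≢1+n (trans (sym inFirst) (trans same inSecond)))
  where
  G′ = descendingColumns (y ∷ []) y ys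
  inFirst : blockOf (col ∷ G′) (c + 0) ≡ 0
  inFirst = blockOf-< col G′ (lastPosition<length c col |col|)
  inSecond : blockOf (col ∷ G′) (c + 1) ≡ suc (blockOf G′ 0)
  inSecond = blockOf-∷-suc c col G′ 0 |col|
descendingColumns-separate c col p (y ∷ ys) |col| (suc i) (s≤s i<) | false =
  ⇔.trans (≢-offset 1 (blockOf-∷-suc c col G′ i |col|) (blockOf-∷-suc c col G′ (suc i) |col|))
          (descendingColumns-separate 0 (y ∷ []) y ys refl i i<)
  where G′ = descendingColumns (y ∷ []) y ys

descendingColumns-onto : ∀ c col p ys → length col ≡ suc c → ∀ t → t < length (descendingColumns col p ys) →
  ∃ λ i → i ≤ length ys × blockOf (descendingColumns col p ys) (c + i) ≡ t
descendingColumns-onto c col p [] |col| zero _ =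
  0 , z≤n , blockOf-< col [] (lastPosition<length c col |col|)
descendingColumns-onto c col p [] |col| (suc t) (s≤s ())
descendingColumns-onto c col p (y ∷ ys) |col| t t< with y <ᵇ p
... | true with descendingColumns-onto (suc c) (col ++ y ∷ []) y ys (length-∷ʳ col y |col|) t t<
...   | i , i≤ , hit = suc i , s≤s i≤ , trans (cong (blockOf (descendingColumns (col ++ y ∷ []) y ys)) (+-suc c i)) hit
descendingColumns-onto c col p (y ∷ ys) |col| zero _ | false =
  0 , z≤n , blockOf-< col (descendingColumns (y ∷ []) y ys) (lastPosition<length c col |col|)
descendingColumns-onto c col p (y ∷ ys) |col| (suc t) (s≤s t<) | false
  with descendingColumns-onto 0 (y ∷ []) y ys refl t t<
... | i , i≤ , hit = suc i , s≤s i≤ , trans (blockOf-∷-suc c col (descendingColumns (y ∷ []) y ys) i |col|) (cong suc hit)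

totalDescents : List (List ℕ) → ℕ
totalDescents Bs = sum (map des Bs)

des-∷ʳ-< : ∀ pre p y → y < p → des ((pre ++ p ∷ []) ++ y ∷ []) ≡ suc (des (pre ++ p ∷ []))
des-∷ʳ-< pre p y y<p
  rewrite ++-assoc pre (p ∷ []) (y ∷ []) | descentsFrom-++ 1 pre p (y ∷ []) | <⇒<ᵇ≡true y<p
        | length-++ (descentsFrom 1 (pre ++ p ∷ [])) {1 + length pre ∷ []} = +-comm _ 1

-- Each letter of p ∷ ys either starts a new column or ends a descent.
descendingColumns-count : ∀ pre p ys → let G = descendingColumns (pre ++ p ∷ []) p ys in
  des (pre ++ p ∷ []) + suc (length ys) ≤ length G + totalDescents G
descendingColumns-count pre p []       = ≤-reflexive (trans (+-comm _ 1) (cong suc (sym (+-identityʳ _))))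
descendingColumns-count pre p (y ∷ ys) with y <ᵇ p in y<ᵇp
... | true  = ≤-trans (≤-reflexive shift) (descendingColumns-count (pre ++ p ∷ []) y ys)
  where
  shift : des (pre ++ p ∷ []) + suc (suc (length ys)) ≡ des ((pre ++ p ∷ []) ++ y ∷ []) + suc (length ys)
  shift = trans (+-suc _ _) (cong (_+ suc (length ys)) (sym (des-∷ʳ-< pre p y (<ᵇ≡true⇒< y<ᵇp))))
... | false = begin
  d + suc (suc (length ys))                             ≡⟨ +-suc d _ ⟩
  suc (d + suc (length ys))                             ≤⟨ s≤s (+-monoʳ-≤ d (descendingColumns-count [] y ys)) ⟩
  suc (d + (length G′ + totalDescents G′))              ≡⟨ cong suc (x∙yz≈y∙xz d (length G′) _) ⟩
  suc (length G′ + (d + totalDescents G′))              ∎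
  where
  open ≤-Reasoning
  d  = des (pre ++ p ∷ [])
  G′ = descendingColumns (y ∷ []) y ys

blockOf-++ : ∀ Tc G q → blockOf (Tc ++ G) (length (concat Tc) + q) ≡ length Tc + blockOf G q
blockOf-++ []       G q = refl
blockOf-++ (B ∷ Tc) G q = begin
  blockOf (B ∷ Tc ++ G) (length (B ++ concat Tc) + q)         ≡⟨ cong (λ m → blockOf (B ∷ Tc ++ G) (m + q)) (length-++ B) ⟩
  blockOf (B ∷ Tc ++ G) (length B + length (concat Tc) + q)   ≡⟨ cong (blockOf (B ∷ Tc ++ G)) (+-assoc (length B) _ q) ⟩
  blockOf (B ∷ Tc ++ G) (length B + (length (concat Tc) + q)) ≡⟨ blockOf-+ B (Tc ++ G) _ ⟩
  suc (blockOf (Tc ++ G) (length (concat Tc) + q))            ≡⟨ cong suc (blockOf-++ Tc G q) ⟩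
  suc (length Tc + blockOf G q)                               ∎
  where open ≡-Reasoning

length-filterᵇ-suffix : ∀ (P : ℕ → Bool) g Tc (G : List (List ℕ)) → (∀ t → t < length G → T (P (g (length Tc + t)))) →
  length G ≤ length (filterᵇ P (applyUpTo g (length (Tc ++ G))))
length-filterᵇ-suffix P g []       []      _ = z≤n
length-filterᵇ-suffix P g []       (B ∷ G) P-G with P (g 0) | P-G 0 (s≤s z≤n)
... | true | _ = s≤s (length-filterᵇ-suffix P (λ i → g (suc i)) [] G (λ t t< → P-G (suc t) (s≤s t<)))
length-filterᵇ-suffix P g (B ∷ Tc) G P-G with P (g 0)
... | true  = ≤-trans (length-filterᵇ-suffix P (λ i → g (suc i)) Tc G P-G) (n≤1+n _)
... | false = length-filterᵇ-suffix P (λ i → g (suc i)) Tc G P-G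

totalDescents-suffix : ∀ (P : ℕ → Bool) g Tc (G : List (List ℕ)) → (∀ t → t < length G → T (P (g (length Tc + t)))) →
  totalDescents G ≤ sum (zipWith (λ c B → if P c then des B else 0) (applyUpTo g (length (Tc ++ G))) (Tc ++ G))
totalDescents-suffix P g []       []      _ = z≤n
totalDescents-suffix P g []       (B ∷ G) P-G with P (g 0) | P-G 0 (s≤s z≤n)
... | true | _ = +-monoʳ-≤ (des B) (totalDescents-suffix P (λ i → g (suc i)) [] G (λ t t< → P-G (suc t) (s≤s t<)))
totalDescents-suffix P g (B ∷ Tc) G P-G =
  ≤-trans (totalDescents-suffix P (λ i → g (suc i)) Tc G P-G) (m≤n+m _ _)

LeadingLetterProperties : List (List ℕ) → List ℕ → ℕ → Set
LeadingLetterProperties π′ bs k =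
    (drop (length (word π′) ∸ k) (word π′) ≡ bs)
    × ((i : ℕ) → suc i < k →
        ((blockOf π′ (bPos π′ k i) ≢ blockOf π′ (bPos π′ k (suc i)))
         ⇔ (nth bs i ≤ nth bs (suc i))))
    × ((j : ℕ) → j + numBlocksWithB π′ k ≡ k → j ≤ descentsInBBlocks π′ k)

module RibbonReading (Tc : List (List ℕ)) (C₀ : List ℕ) (x : ℕ) (rest : List ℕ) where

  G : List (List ℕ)
  G = descendingColumns (C₀ ++ x ∷ []) x rest

  π′ : List (List ℕ)
  π′ = Tc ++ G

  k : ℕ
  k = suc (length rest)

  prefix : List ℕ
  prefix = concat Tc ++ C₀

  word-π′ : word π′ ≡ prefix ++ x ∷ rest
  word-π′ = begin
    concat (Tc ++ G)                    ≡⟨ sym (concat-++ Tc G) ⟩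
    concat Tc ++ concat G               ≡⟨ cong (concat Tc ++_) (concat-descendingColumns (C₀ ++ x ∷ []) x rest) ⟩
    concat Tc ++ (C₀ ++ x ∷ []) ++ rest ≡⟨ cong (concat Tc ++_) (++-assoc C₀ (x ∷ []) rest) ⟩
    concat Tc ++ C₀ ++ x ∷ rest         ≡⟨ sym (++-assoc (concat Tc) C₀ (x ∷ rest)) ⟩
    prefix ++ x ∷ rest                  ∎
    where open ≡-Reasoning

  length-prefix : length (word π′) ∸ k ≡ length prefix
  length-prefix rewrite word-π′ | length-++ prefix {x ∷ rest} = m+n∸n≡m (length prefix) k

  blockOf-bPos : ∀ i → blockOf π′ (bPos π′ k i) ≡ length Tc + blockOf G (length C₀ + i)
  blockOf-bPos i = trans (cong (blockOf π′) position) (blockOf-++ Tc G (length C₀ + i))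
    where
    position : bPos π′ k i ≡ length (concat Tc) + (length C₀ + i)
    position = trans (cong (_+ i) (trans length-prefix (length-++ (concat Tc)))) (+-assoc _ (length C₀) i)

  |C₀∷ʳx| : length (C₀ ++ x ∷ []) ≡ suc (length C₀)
  |C₀∷ʳx| = length-++-comm C₀ (x ∷ [])

  leading-suffix : drop (length (word π′) ∸ k) (word π′) ≡ x ∷ rest
  leading-suffix = trans (cong₂ drop length-prefix word-π′) (drop-length-++ prefix (x ∷ rest))

  separated : ∀ i → suc i < k →
    (blockOf π′ (bPos π′ k i) ≢ blockOf π′ (bPos π′ k (suc i))) ⇔ (nth (x ∷ rest) i ≤ nth (x ∷ rest) (suc i))
  separated i (s≤s i<) =
    ⇔.trans (≢-offset (length Tc) (blockOf-bPos i) (blockOf-bPos (suc i)))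
            (descendingColumns-separate (length C₀) (C₀ ++ x ∷ []) x rest |C₀∷ʳx| i i<)

  every-column-has-b : ∀ t → t < length G → T (containsB π′ k (length Tc + t))
  every-column-has-b t t< with descendingColumns-onto (length C₀) (C₀ ++ x ∷ []) x rest |C₀∷ʳx| t t<
  ... | i , i≤ , hit = any⁺ _ (lose (∈-upTo⁺ (s≤s i≤)) (≡⇒≡ᵇ _ _ (trans (blockOf-bPos i) (cong (length Tc +_) hit))))

  k≤blocks+descents : k ≤ numBlocksWithB π′ k + descentsInBBlocks π′ k
  k≤blocks+descents = begin
    k                                      ≤⟨ m≤n+m k _ ⟩
    des (C₀ ++ x ∷ []) + k                 ≤⟨ descendingColumns-count C₀ x rest ⟩
    length G + totalDescents G             ≤⟨ +-mono-≤ (length-filterᵇ-suffix _ (λ i → i) Tc G every-column-has-b)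
                                                      (totalDescents-suffix _ (λ i → i) Tc G every-column-has-b) ⟩
    numBlocksWithB π′ k + descentsInBBlocks π′ k ∎
    where open ≤-Reasoning

  properties : LeadingLetterProperties π′ (x ∷ rest) k
  properties = leading-suffix , separated , descents-bound
    where
    descents-bound : ∀ j → j + numBlocksWithB π′ k ≡ k → j ≤ descentsInBBlocks π′ k
    descents-bound j j+blocks≡k = +-cancelˡ-≤ blocks j _ (subst (_≤ blocks + descentsInBBlocks π′ k) blocks+j≡k k≤blocks+descents)
      where
      blocks = numBlocksWithB π′ k
      blocks+j≡k : k ≡ blocks + j
      blocks+j≡k = sym (trans (+-comm blocks j) j+blocks≡k)

ribbon-columns : ∀ Tc C₀ {bs ηs x rest} → ηs ≡ descents bs → bs ≡ x ∷ rest →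
  Tc ++ ribbonCols C₀ (cutRows bs 0 ηs) ≡ Tc ++ descendingColumns (C₀ ++ x ∷ []) x rest
ribbon-columns Tc C₀ {x = x} {rest} refl refl =
  cong (Tc ++_) (trans (cong (ribbonCols C₀) (cutRows-descents 0 x rest)) (ribbonCols-ascendingRuns C₀ x rest))

readPhi-columns : ∀ π {x rest} → Arranged (minimajBlocks π) → leading π ≡ x ∷ rest →
  ∃₂ λ Tc C₀ → readPhi π ≡ Tc ++ descendingColumns (C₀ ++ x ∷ []) x rest
readPhi-columns π arranged leading≡ = _ , _ , ribbon-columns _ _ (descentBlocks 0 arranged) leading≡

leading-∷ : ∀ B Bs → ∃₂ λ x rest → leading (B ∷ Bs) ≡ x ∷ rest
leading-∷ B Bs with minimajBlocks Bs
... | []     = _ , _ , refl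
... | C ∷ Cs = _ , _ , refl

length-minimajBlocks : ∀ π → length (minimajBlocks π) ≡ length π
length-minimajBlocks []       = refl
length-minimajBlocks (B ∷ Bs) with minimajBlocks Bs | length-minimajBlocks Bs
... | []     | |Bs| = cong suc |Bs|
... | C ∷ Cs | |Bs| = cong suc |Bs|

length-leading : ∀ π → length (leading π) ≡ length π
length-leading π = trans (length-map headOr0 (minimajBlocks π)) (length-minimajBlocks π)

lemma5p2 : (n k : ℕ) (π : List (List ℕ)) → IsOP n k π →
    (drop (length (word (readPhi π)) ∸ k) (word (readPhi π)) ≡ leading π)
    × ((i : ℕ) → suc i < k →
        ((blockOf (readPhi π) (bPos (readPhi π) k i)
            ≢ blockOf (readPhi π) (bPos (readPhi π) k (suc i)))
         ⇔ (nth (leading π) i ≤ nth (leading π) (suc i))))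
    × ((j : ℕ) → j + numBlocksWithB (readPhi π) k ≡ k →
        j ≤ descentsInBBlocks (readPhi π) k)
lemma5p2 n k [] (refl , _ , _) = refl , (λ _ ()) , λ { zero _ → z≤n ; (suc _) () }
lemma5p2 n k (B ∷ Bs) (|π|≡k , blocks , _) with leading-∷ B Bs
... | x , rest , leading≡ with readPhi-columns (B ∷ Bs) (minimajBlocks-arranged (B ∷ Bs) blocks) leading≡
...   | Tc , C₀ , readPhi≡ =
  subst₂ (λ π′ bs → LeadingLetterProperties π′ bs k) (sym readPhi≡) (sym leading≡)
    (subst (LeadingLetterProperties (RibbonReading.π′ Tc C₀ x rest) (x ∷ rest)) k≡ (RibbonReading.properties Tc C₀ x rest))
  where
  k≡ : suc (length rest) ≡ k
  k≡ = trans (sym (cong length leading≡)) (trans (length-leading (B ∷ Bs)) |π|≡k)
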